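{- Let $\Psi$ be a context of parameters with positive types and $N$ a simple linear pattern with $\Psi\vdash N\Uparrow A$. Then for every $Q$ such that $\Psi\vdash\mathrm{Not}(N)\Rightarrow Q:A$ and every closed $M$, it is not the case that both $\Psi\vdash M\in\|N\|:A$ and $\Psi\vdash M\in\|Q\|:A$.
   Context: Strict $\lambda$-calculus over a signature $\Sigma$: labels $k\in\{1,0,u\}$; types $A::=a\mid A_1\to^kA_2$; terms $c\mid x\mid\lambda x^k{:}A.M\mid M_1M_2^k$. Typing $\Gamma;\Omega;\Delta\vdash M:A$ (unrestricted, irrelevant, strict; disjoint; commas are disjoint unions): $c{:}A\in\Sigma$ gives $\Gamma;\Omega;\cdot\vdash c:A$; $(\Gamma,x{:}A);\Omega;\cdot\vdash x:A$; $\Gamma;\Omega;x{:}A\vdash x:A$ (no rule for $\Omega$); $\lambda x^u,\lambda x^0,\lambda x^1$ typed at $A\to^uB,A\to^0B,A\to^1B$ from the body typed at $B$ with $x{:}A$ added to $\Gamma,\Omega,\Delta$ respectively; $\Gamma;\Omega;\Delta\vdash MN^u:B$ from $\Gamma;\Omega;\Delta\vdash M:A\to^uB$ and $(\Gamma,\Delta);\Omega;\cdot\vdash N:A$; $\Gamma;\Omega;\Delta\vdash MN^0:B$ from $\Gamma;\Omega;\Delta\vdash M:A\to^0B$ and $(\Gamma,\Omega,\Delta);\cdot;\cdot\vdash N:A$; $\Gamma;\Omega;(\Delta_M,\Delta_N)\vdash MN^1:B$ from $(\Gamma,\Delta_N);\Omega;\Delta_M\vdash M:A\to^1B$ and $(\Gamma,\Delta_M);\Omega;\Delta_N\vdash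 N:A$. Simple patterns: positive $P::=a\mid N\to^1P$, negative $N::=a\mid P\to^uN$; $\Sigma,\Psi$ declare positive types; existential variables are a separate class. For $\Psi=x_1{:}A_1,\dots,x_n{:}A_n$ (fixed order) $\Phi=x_1^{k_1}\dots x_n^{k_n}$, $\Phi(x_i)=k_i$, $\Psi^u$ all labels $u$; $\Gamma;\Omega;\Delta\vdash\Phi\ ok$ iff $\Gamma,\Omega,\Delta$ partition $\Psi$ with $x$ in $\Gamma/\Omega/\Delta$ iff $\Phi(x)=u/0/1$. Generalized variable $E\,\Phi$ at atomic $a$, $E{:}A_1\to^{k_1}\cdots A_n\to^{k_n}a$. $\Psi\vdash M\Uparrow A$: $\lambda x^u{:}P.M\Uparrow P\to^uB$ if $(\Psi,x{:}P)\vdash M\Uparrow B$; $h\,M_1^1\dots M_n^1\Uparrow a$ for $h\in\mathrm{dom}(\Sigma\cup\Psi)$ of type $A_1\to^1\cdots\to^1A_n\to^1a$ with $M_i\Uparrow A_i$; $E\,\Phi\Uparrow a$. Linear: no existential variable twice; closed: none. Convention: fresh $Z\,\Phi$ at non-atomic type $B_1\to^u\cdots\to^uB_m\to^ua$ means $\lambda y_1^u{:}B_1\dots\lambda y_m^u{:}B_m.Z\,\Phi\,y_1^u\dots y_m^u$. Ground instances (closed $M$): $\Gamma;\Omega;\Delta\vdash\Phi\ ok$ and $\Gamma;\Omega;\Delta\vdash M:a$ give $\Psi\vdash M\in\|E\Phi\|:a$; $(\Psi,x{:}A)\vdash M\in\|N\|:B$ gives $\Psi\vdash\lambda x^u{:}A.M\in\|\lambda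 x^u{:}A.N\|:A\to^uB$; $h{:}A_1\to^1\cdots\to^1A_n\to^1a$ in $\Sigma\cup\Psi$ and $\Psi\vdash M_i\in\|N_i\|:A_i$ give $\Psi\vdash h\,M_1^1\dots M_n^1\in\|h\,N_1^1\dots N_n^1\|:a$. Complement ($Z$'s fresh; $\mathrm{Not}(1)=0$, $\mathrm{Not}(0)=1$, $\mathrm{Not}(u)=u$; $\mathrm{Not}_i(\Phi)$, defined when $\Phi(x_i)\in\{0,1\}$, labels $x_i$ by $\mathrm{Not}(\Phi(x_i))$ and all others $u$): $\Psi\vdash\mathrm{Not}(E\Phi)\Rightarrow Z\,\mathrm{Not}_i(\Phi):a$ when defined; if $(\Psi,x{:}A)\vdash\mathrm{Not}(M)\Rightarrow N:B$ then $\Psi\vdash\mathrm{Not}(\lambda x^u{:}A.M)\Rightarrow\lambda x^u{:}A.N:A\to^uB$; for $h{:}A_1\to^1\cdots\to^1A_n\to^1a$ in $\Sigma\cup\Psi$: $\Psi\vdash\mathrm{Not}(h\,M_1^1\dots M_n^1)\Rightarrow g\,(Z_1\Psi^u)^1\dots(Z_m\Psi^u)^1:a$ for any $g\ne h$ in $\Sigma\cup\Psi$ of type $A'_1\to^1\cdots\to^1A'_m\to^1a$; and if $\Psi\vdash\mathrm{Not}(M_i)\Rightarrow N:A_i$ then $\Psi\vdash\mathrm{Not}(h\,M_1^1\dots M_n^1)\Rightarrow h\,(Z_1\Psi^u)^1\dots(Z_{i-1}\Psi^u)^1N^1(Z_{i+1}\Psi^u)^1\dots(Z_n\Psi^u)^1:a$.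 -}

module Defs where

open import Data.Nat using (ℕ; zero; suc)
open import Data.Fin using (Fin)
open import Data.List using (List; []; _∷_; _++_; length)
open import Data.List.Relation.Unary.Unique.Propositional using (Unique)
open import Data.Vec using (Vec; []; _∷_; lookup; replicate; _[_]≔_)
open import Data.Vec.Relation.Unary.All using () renaming (All to VAll)
open import Relation.Binary.PropositionalEquality using (_≡_; _≢_)

data Lbl : Set where
  l1 l0 lu : Lbl

data Tp : Set where
  base   : ℕ → Tp
  _⇒[_]_ : Tp → Lbl → Tp → Tp

notL : Lbl → Lbl
notL l1 = l0
notL l0 = l1
notL lu = lu

mutual
  data Pos : Tp → Set where
    pos-base : ∀ {a} → Pos (base a)
    pos-arr  : ∀ {N P} → Neg N → Pos P → Pos (N ⇒[ l1 ] P)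

  data Neg : Tp → Set where
    neg-base : ∀ {a} → Neg (base a)
    neg-arr  : ∀ {P N} → Pos P → Neg N → Neg (P ⇒[ lu ] N)

Sig : Set
Sig = List Tp

data _∋_∶_ : Sig → ℕ → Tp → Set where
  here  : ∀ {Σ A} → (A ∷ Σ) ∋ 0 ∶ A
  there : ∀ {Σ A B c} → Σ ∋ c ∶ A → (B ∷ Σ) ∋ suc c ∶ A

-- Terms of the strict λ-calculus (closed: no existential variables),
-- scoped de Bruijn over a context of length n (the parameters Ψ).

data Tm (n : ℕ) : Set where
  con : ℕ → Tm n
  var : Fin n → Tm n
  lam : Lbl → Tp → Tm (suc n) → Tm n
  app : Tm n → Lbl → Tm n → Tm n

-- A context of n variables split into Γ;Ω;Δ is represented by a vector
-- of labels L : x ∈ Γ / Ω / Δ  iff  L(x) = u / 0 / 1.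

-- (Γ,Δ);Ω;·   from   Γ;Ω;Δ
toU1 : Lbl → Lbl
toU1 l1 = lu
toU1 k  = k

-- Δ = Δ_M , Δ_N : labels for M and for N in the strict application rule
data Split : ∀ {n} → Vec Lbl n → Vec Lbl n → Vec Lbl n → Set where
  []   : Split [] [] []
  su   : ∀ {n} {L LM LN : Vec Lbl n} → Split L LM LN → Split (lu ∷ L) (lu ∷ LM) (lu ∷ LN)
  s0   : ∀ {n} {L LM LN : Vec Lbl n} → Split L LM LN → Split (l0 ∷ L) (l0 ∷ LM) (l0 ∷ LN)
  s1M  : ∀ {n} {L LM LN : Vec Lbl n} → Split L LM LN → Split (l1 ∷ L) (l1 ∷ LM) (lu ∷ LN)
  s1N  : ∀ {n} {L LM LN : Vec Lbl n} → Split L LM LN → Split (l1 ∷ L) (lu ∷ LM) (l1 ∷ LN)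

NoStrict : ∀ {n} → Vec Lbl n → Set
NoStrict = VAll (λ k → k ≢ l1)

mapL : ∀ {n} → (Lbl → Lbl) → Vec Lbl n → Vec Lbl n
mapL f [] = []
mapL f (k ∷ L) = f k ∷ mapL f L

-- Typing  Γ;Ω;Δ ⊢ M : A  written  Typed Σ Γs L M A  (Γs : types of the n variables)
data Typed (Σ : Sig) : ∀ {n} → Vec Tp n → Vec Lbl n → Tm n → Tp → Set where
  t-con  : ∀ {n} {Γs : Vec Tp n} {L c A} →
           Σ ∋ c ∶ A → NoStrict L → Typed Σ Γs L (con c) A
  t-varU : ∀ {n} {Γs : Vec Tp n} {L x} →
           lookup L x ≡ lu → NoStrict L → Typed Σ Γs L (var x) (lookup Γs x)
  t-varS : ∀ {n} {Γs : Vec Tp n} {L x} →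
           lookup L x ≡ l1 → (∀ y → y ≢ x → lookup L y ≢ l1) →
           Typed Σ Γs L (var x) (lookup Γs x)
  t-lam  : ∀ {n} {Γs : Vec Tp n} {L k A B M} →
           Typed Σ (A ∷ Γs) (k ∷ L) M B → Typed Σ Γs L (lam k A M) (A ⇒[ k ] B)
  t-appU : ∀ {n} {Γs : Vec Tp n} {L A B M N} →
           Typed Σ Γs L M (A ⇒[ lu ] B) → Typed Σ Γs (mapL toU1 L) N A →
           Typed Σ Γs L (app M lu N) B
  t-app0 : ∀ {n} {Γs : Vec Tp n} {L A B M N} →
           Typed Σ Γs L M (A ⇒[ l0 ] B) → Typed Σ Γs (replicate n lu) N A →
           Typed Σ Γs L (app M l0 N) B
  t-app1 : ∀ {n} {Γs : Vec Tp n} {L LM LN A B M N} →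
           Split L LM LN →
           Typed Σ Γs LM M (A ⇒[ l1 ] B) → Typed Σ Γs LN N A →
           Typed Σ Γs L (app M l1 N) B

-- Simple patterns.  Heads h ∈ dom(Σ ∪ Ψ); existential variables are named
-- by ℕ (a separate class); E Φ carries a label for every variable in scope.

data Head (n : ℕ) : Set where
  hc : ℕ → Head n
  hv : Fin n → Head n

data Pat (n : ℕ) : Set where
  plam : Tp → Pat (suc n) → Pat n            -- λx^u:A. N
  phd  : Head n → List (Pat n) → Pat n       -- h N₁¹ … Nₙ¹
  pev  : ℕ → Vec Lbl n → Pat n

data HdTy (Σ : Sig) {n} (Ψ : Vec Tp n) : Head n → Tp → Set where
  hd-c : ∀ {c A} → Σ ∋ c ∶ A → HdTy Σ Ψ (hc c) A
  hd-v : ∀ {x} → HdTy Σ Ψ (hv x) (lookup Ψ x)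

hdTm : ∀ {n} → Head n → Tm n
hdTm (hc c) = con c
hdTm (hv x) = var x

spine : ∀ {n} → Tm n → List (Tm n) → Tm n
spine f [] = f
spine f (M ∷ Ms) = spine (app f l1 M) Ms

data Arrs1 : Tp → List Tp → ℕ → Set where
  ar-base : ∀ {a} → Arrs1 (base a) [] a
  ar-cons : ∀ {A B As a} → Arrs1 B As a → Arrs1 (A ⇒[ l1 ] B) (A ∷ As) a

mutual
  data Up (Σ : Sig) : ∀ {n} → Vec Tp n → Pat n → Tp → Set where
    up-lam : ∀ {n} {Ψ : Vec Tp n} {P N B} →
             Pos P → Up Σ (P ∷ Ψ) N B → Up Σ Ψ (plam P N) (P ⇒[ lu ] B)
    up-hd  : ∀ {n} {Ψ : Vec Tp n} {h A Ns a} →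
             HdTy Σ Ψ h A → UpArgs Σ Ψ Ns A a → Up Σ Ψ (phd h Ns) (base a)
    up-ev  : ∀ {n} {Ψ : Vec Tp n} {E Φ a} → Up Σ Ψ (pev E Φ) (base a)

  data UpArgs (Σ : Sig) {n} (Ψ : Vec Tp n) : List (Pat n) → Tp → ℕ → Set where
    ua-nil  : ∀ {a} → UpArgs Σ Ψ [] (base a) a
    ua-cons : ∀ {N Ns A B a} → Up Σ Ψ N A → UpArgs Σ Ψ Ns B a →
              UpArgs Σ Ψ (N ∷ Ns) (A ⇒[ l1 ] B) a

mutual
  evs : ∀ {n} → Pat n → List ℕ
  evs (plam _ N) = evs N
  evs (phd _ Ns) = evsL Ns
  evs (pev E _)  = E ∷ []

  evsL : ∀ {n} → List (Pat n) → List ℕ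
  evsL [] = []
  evsL (N ∷ Ns) = evs N ++ evsL Ns

Linear : ∀ {n} → Pat n → Set
Linear N = Unique (evs N)

mutual
  data Inst (Σ : Sig) : ∀ {n} → Vec Tp n → Tm n → Pat n → Tp → Set where
    in-ev  : ∀ {n} {Ψ : Vec Tp n} {Φ M E a} →
             Typed Σ Ψ Φ M (base a) → Inst Σ Ψ M (pev E Φ) (base a)
    in-lam : ∀ {n} {Ψ : Vec Tp n} {A M N B} →
             Inst Σ (A ∷ Ψ) M N B → Inst Σ Ψ (lam lu A M) (plam A N) (A ⇒[ lu ] B)
    in-hd  : ∀ {n} {Ψ : Vec Tp n} {h A Ms Ns a} →
             HdTy Σ Ψ h A → InstArgs Σ Ψ Ms Ns A a →
             Inst Σ Ψ (spine (hdTm h) Ms) (phd h Ns) (base a)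

  data InstArgs (Σ : Sig) {n} (Ψ : Vec Tp n) : List (Tm n) → List (Pat n) → Tp → ℕ → Set where
    ia-nil  : ∀ {a} → InstArgs Σ Ψ [] [] (base a) a
    ia-cons : ∀ {M Ms N Ns A B a} → Inst Σ Ψ M N A → InstArgs Σ Ψ Ms Ns B a →
              InstArgs Σ Ψ (M ∷ Ms) (N ∷ Ns) (A ⇒[ l1 ] B) a

notAt : ∀ {n} → Vec Lbl n → Fin n → Vec Lbl n
notAt {n} Φ i = replicate n lu [ i ]≔ notL (lookup Φ i)

-- a fresh Z Ψ^u at (negative) type B₁ →ᵘ ⋯ →ᵘ Bₘ →ᵘ a, by the convention
-- λy₁^u:B₁ … λyₘ^u:Bₘ. Z Ψ^u y₁^u … yₘ^u  (i.e. Z applied to all variables, labelled u)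
data FreshP : ∀ {n} → Pat n → Tp → Set where
  fr-base : ∀ {n Z a} → FreshP {n} (pev Z (replicate n lu)) (base a)
  fr-lam  : ∀ {n} {P : Pat (suc n)} {A B} → FreshP P B → FreshP (plam A P) (A ⇒[ lu ] B)

data FreshArgs {n} : List (Pat n) → List Tp → Set where
  fa-nil  : FreshArgs [] []
  fa-cons : ∀ {Q Qs A As} → FreshP Q A → FreshArgs Qs As → FreshArgs (Q ∷ Qs) (A ∷ As)

mutual
  data NotR (Σ : Sig) : ∀ {n} → Vec Tp n → Pat n → Pat n → Tp → Set where
    not-ev    : ∀ {n} {Ψ : Vec Tp n} {E Z Φ a} (i : Fin n) →
                lookup Φ i ≢ lu →
                NotR Σ Ψ (pev E Φ) (pev Z (notAt Φ i)) (base a)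
    not-lam   : ∀ {n} {Ψ : Vec Tp n} {A M N B} →
                NotR Σ (A ∷ Ψ) M N B → NotR Σ Ψ (plam A M) (plam A N) (A ⇒[ lu ] B)
    not-other : ∀ {n} {Ψ : Vec Tp n} {h g A As A' As' Ms Qs a} →
                HdTy Σ Ψ h A → Arrs1 A As a → length Ms ≡ length As →
                HdTy Σ Ψ g A' → Arrs1 A' As' a → g ≢ h →
                FreshArgs Qs As' →
                NotR Σ Ψ (phd h Ms) (phd g Qs) (base a)
    not-arg   : ∀ {n} {Ψ : Vec Tp n} {h A As Ms Qs a} →
                HdTy Σ Ψ h A → Arrs1 A As a →
                NotArgs Σ Ψ Ms Qs As →
                NotR Σ Ψ (phd h Ms) (phd h Qs) (base a)

  data NotArgs (Σ : Sig) {n} (Ψ : Vec Tp n) : List (Pat n) → List (Pat n) → List Tp → Set where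
    na-here  : ∀ {M Ms N Qs A As} →
               NotR Σ Ψ M N A → length Ms ≡ length As → FreshArgs Qs As →
               NotArgs Σ Ψ (M ∷ Ms) (N ∷ Qs) (A ∷ As)
    na-there : ∀ {M Ms Q Qs A As} →
               FreshP Q A → NotArgs Σ Ψ Ms Qs As →
               NotArgs Σ Ψ (M ∷ Ms) (Q ∷ Qs) (A ∷ As)

{-# OPTIONS --safe #-}
module Submission where

-- Every rule of the complement changes something that an instance is forced
-- to reveal: the head (two spines with different heads differ), one argument
-- (disjoint by induction), or, at an existential variable E Φ, the status of a
-- parameter xᵢ that Φ declares strict and Notᵢ(Φ) irrelevant, or vice versa.
-- A strict variable occurs in every term typed under it, outside the
-- arguments of irrelevant applications, and an irrelevant one never occurs
-- there; so no term is typed under both labellings.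

open import Defs
open import Data.Nat using (ℕ)
open import Data.Fin using (Fin; zero; suc)
open import Data.Fin.Properties using (_≟_)
open import Data.List using (List; []; _∷_; _++_; _∷ʳ_)
open import Data.List.Properties using (++-identityʳ; ∷ʳ-++)
open import Data.List.Relation.Unary.All using (All)
open import Data.Vec using (Vec; _∷_; lookup; replicate)
open import Data.Vec.Properties using (lookup∘update)
open import Data.Vec.Relation.Unary.All using () renaming (All to VAll)
open import Data.Vec.Relation.Unary.All.Properties using (lookup⁺)
open import Data.Product using (Σ-syntax; _×_; _,_; proj₁; proj₂; map₁; map₂)
open import Data.Product.Properties using (,-injective)
open import Data.Sum using (_⊎_; inj₁; inj₂)
open import Relation.Nullary using (¬_; yes; no; contradiction)
open import Relation.Binary.PropositionalEquality using (_≡_; _≢_; refl; sym; trans; cong; module ≡-Reasoning)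

private
  variable
    n : ℕ
    Σ : Sig
    Ψ : Vec Tp n
    L LM LN : Vec Lbl n
    M : Tm n
    A : Tp
    a : ℕ
    i : Fin n

-- Occurrences inside the argument of an irrelevant application are not
-- counted: irrelevant variables may appear there.
data OccursRelevantly : Fin n → Tm n → Set where
  var  : OccursRelevantly i (var i)
  lam  : ∀ {k B M} → OccursRelevantly (suc i) M → OccursRelevantly i (lam k B M)
  fun  : ∀ {k M N} → OccursRelevantly i M → OccursRelevantly i (app M k N)
  argU : ∀ {M N} → OccursRelevantly i N → OccursRelevantly i (app M lu N)
  arg1 : ∀ {M N} → OccursRelevantly i N → OccursRelevantly i (app M l1 N)

split-strict : Split L LM LN → (i : Fin n) → lookup L i ≡ l1 →
               lookup LM i ≡ l1 ⊎ lookup LN i ≡ l1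
split-strict (s1M s) zero    _  = inj₁ refl
split-strict (s1N s) zero    _  = inj₂ refl
split-strict (su s)  (suc i) Li = split-strict s i Li
split-strict (s0 s)  (suc i) Li = split-strict s i Li
split-strict (s1M s) (suc i) Li = split-strict s i Li
split-strict (s1N s) (suc i) Li = split-strict s i Li

split-irrelevant : Split L LM LN → (i : Fin n) → lookup L i ≡ l0 →
                   lookup LM i ≡ l0 × lookup LN i ≡ l0
split-irrelevant (s0 s)  zero    _  = refl , refl
split-irrelevant (su s)  (suc i) Li = split-irrelevant s i Li
split-irrelevant (s0 s)  (suc i) Li = split-irrelevant s i Li
split-irrelevant (s1M s) (suc i) Li = split-irrelevant s i Li
split-irrelevant (s1N s) (suc i) Li = split-irrelevant s i Li

lookup-mapL : (f : Lbl → Lbl) (L : Vec Lbl n) (i : Fin n) →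
              lookup (mapL f L) i ≡ f (lookup L i)
lookup-mapL f (k ∷ L) zero    = refl
lookup-mapL f (k ∷ L) (suc i) = lookup-mapL f L i

strict⇒occursRelevantly : Typed Σ Ψ L M A → (i : Fin n) → lookup L i ≡ l1 →
                          OccursRelevantly i M
strict⇒occursRelevantly (t-con _ noStrict) i Li = contradiction Li (lookup⁺ noStrict i)
strict⇒occursRelevantly (t-varU _ noStrict) i Li = contradiction Li (lookup⁺ noStrict i)
strict⇒occursRelevantly (t-varS {x = x} _ othersNotStrict) i Li with i ≟ x
... | yes refl = var
... | no i≢x   = contradiction Li (othersNotStrict i i≢x)
strict⇒occursRelevantly (t-lam t) i Li = lam (strict⇒occursRelevantly t (suc i) Li)
strict⇒occursRelevantly (t-appU t _) i Li = fun (strict⇒occursRelevantly t i Li)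
strict⇒occursRelevantly (t-app0 t _) i Li = fun (strict⇒occursRelevantly t i Li)
strict⇒occursRelevantly (t-app1 s t u) i Li with split-strict s i Li
... | inj₁ LMi = fun  (strict⇒occursRelevantly t i LMi)
... | inj₂ LNi = arg1 (strict⇒occursRelevantly u i LNi)

irrelevant⇒¬occursRelevantly : Typed Σ Ψ L M A → (i : Fin n) → lookup L i ≡ l0 →
                               ¬ OccursRelevantly i M
irrelevant⇒¬occursRelevantly (t-varU Li≡u _) i Li var = contradiction (trans (sym Li≡u) Li) λ ()
irrelevant⇒¬occursRelevantly (t-varS Li≡1 _) i Li var = contradiction (trans (sym Li≡1) Li) λ ()
irrelevant⇒¬occursRelevantly (t-lam t) i Li (lam o) = irrelevant⇒¬occursRelevantly t (suc i) Li o
irrelevant⇒¬occursRelevantly (t-appU t _) i Li (fun o) = irrelevant⇒¬occursRelevantly t i Li o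
irrelevant⇒¬occursRelevantly {L = L} (t-appU _ u) i Li (argU o) =
  irrelevant⇒¬occursRelevantly u i (trans (lookup-mapL toU1 L i) (cong toU1 Li)) o
irrelevant⇒¬occursRelevantly (t-app0 t _) i Li (fun o) = irrelevant⇒¬occursRelevantly t i Li o
irrelevant⇒¬occursRelevantly (t-app1 s t _) i Li (fun o) =
  irrelevant⇒¬occursRelevantly t i (proj₁ (split-irrelevant s i Li)) o
irrelevant⇒¬occursRelevantly (t-app1 s _ u) i Li (arg1 o) =
  irrelevant⇒¬occursRelevantly u i (proj₂ (split-irrelevant s i Li)) o

notAt-disjoint : (Φ : Vec Lbl n) (i : Fin n) → lookup Φ i ≢ lu →
                 Typed Σ Ψ Φ M A → ¬ Typed Σ Ψ (notAt Φ i) M A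
notAt-disjoint {n} Φ i Φi≢u t t′ with lookup Φ i in Φi
... | l1 = irrelevant⇒¬occursRelevantly t′ i (lookup∘update i (replicate n lu) l0)
             (strict⇒occursRelevantly t i Φi)
... | l0 = irrelevant⇒¬occursRelevantly t i Φi
             (strict⇒occursRelevantly t′ i (lookup∘update i (replicate n lu) l1))
... | lu = Φi≢u refl

unspine : Tm n → Tm n × List (Tm n)
unspine (app f l1 x) = map₂ (_∷ʳ x) (unspine f)
unspine t            = t , []

unspine-spine : (f : Tm n) (xs : List (Tm n)) →
                unspine (spine f xs) ≡ map₂ (_++ xs) (unspine f)
unspine-spine f []       = cong (proj₁ (unspine f) ,_) (sym (++-identityʳ _))
unspine-spine f (x ∷ xs) = trans (unspine-spine (app f l1 x) xs)
                                 (cong (proj₁ (unspine f) ,_) (∷ʳ-++ (proj₂ (unspine f)) x xs))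

unspine-spine-hdTm : (h : Head n) (xs : List (Tm n)) → unspine (spine (hdTm h) xs) ≡ (hdTm h , xs)
unspine-spine-hdTm (hc c) xs = unspine-spine (con c) xs
unspine-spine-hdTm (hv x) xs = unspine-spine (var x) xs

hdTm-injective : {h g : Head n} → hdTm h ≡ hdTm g → h ≡ g
hdTm-injective {h = hc _} {hc _} refl = refl
hdTm-injective {h = hv _} {hv _} refl = refl
hdTm-injective {h = hc _} {hv _} ()
hdTm-injective {h = hv _} {hc _} ()

spine-hdTm-injective : {h g : Head n} {xs ys : List (Tm n)} →
                       spine (hdTm h) xs ≡ spine (hdTm g) ys → h ≡ g × xs ≡ ys
spine-hdTm-injective {h = h} {g} {xs} {ys} eq = map₁ hdTm-injective (,-injective (begin
  (hdTm h , xs)               ≡⟨ unspine-spine-hdTm h xs ⟨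
  unspine (spine (hdTm h) xs) ≡⟨ cong unspine eq ⟩
  unspine (spine (hdTm g) ys) ≡⟨ unspine-spine-hdTm g ys ⟩
  (hdTm g , ys)               ∎))
  where open ≡-Reasoning

∋-functional : ∀ {c B} → Σ ∋ c ∶ A → Σ ∋ c ∶ B → A ≡ B
∋-functional here      here      = refl
∋-functional (there p) (there q) = ∋-functional p q

hdTy-functional : ∀ {h B} → HdTy Σ Ψ h A → HdTy Σ Ψ h B → A ≡ B
hdTy-functional (hd-c p) (hd-c q) = ∋-functional p q
hdTy-functional hd-v     hd-v     = refl

inst-spine-inv : ∀ {g Qs} (h : Head n) (xs : List (Tm n)) →
                 Inst Σ Ψ (spine (hdTm h) xs) (phd g Qs) (base a) →
                 g ≡ h × Σ[ B ∈ Tp ] HdTy Σ Ψ g B × InstArgs Σ Ψ xs Qs B a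
inst-spine-inv h xs j = invert j refl
  where
  invert : ∀ {M g Qs} → Inst Σ Ψ M (phd g Qs) (base a) → M ≡ spine (hdTm h) xs →
           g ≡ h × Σ[ B ∈ Tp ] HdTy Σ Ψ g B × InstArgs Σ Ψ xs Qs B a
  invert (in-hd {h = g} {Ms = ys} g∶B js) eq with spine-hdTm-injective {h = g} {h} {ys} {xs} eq
  ... | refl , refl = refl , _ , g∶B , js

not-disjoint : ∀ {N Q} → NotR Σ Ψ N Q A → Inst Σ Ψ M N A → ¬ Inst Σ Ψ M Q A

notArgs-disjoint : ∀ {Ns Qs As Ms} → NotArgs Σ Ψ Ns Qs As → Arrs1 A As a →
                   InstArgs Σ Ψ Ms Ns A a → ¬ InstArgs Σ Ψ Ms Qs A a

not-disjoint (not-ev {Φ = Φ} i Φi≢u) (in-ev t) (in-ev t′) = notAt-disjoint Φ i Φi≢u t t′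
not-disjoint (not-lam r) (in-lam j) (in-lam j′) = not-disjoint r j j′
not-disjoint (not-other {h = h} _ _ _ _ _ g≢h _) (in-hd {Ms = xs} _ _) j′ =
  g≢h (proj₁ (inst-spine-inv h xs j′))
not-disjoint (not-arg {h = h} h∶A A⇒a rs) (in-hd {Ms = xs} h∶B js) j′ with inst-spine-inv h xs j′
... | refl , _ , h∶B′ , js′ with hdTy-functional h∶B h∶A | hdTy-functional h∶B′ h∶A
...   | refl | refl = notArgs-disjoint rs A⇒a js js′

notArgs-disjoint (na-here r _ _) (ar-cons _) (ia-cons j _) (ia-cons j′ _) = not-disjoint r j j′
notArgs-disjoint (na-there _ rs) (ar-cons A⇒a) (ia-cons _ js) (ia-cons _ js′) =
  notArgs-disjoint rs A⇒a js js′

lemma6p4 : (Σ : Sig) → All Pos Σ →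
           {n : ℕ} (Ψ : Vec Tp n) → VAll Pos Ψ →
           (N : Pat n) (A : Tp) → Linear N → Up Σ Ψ N A →
           (Q : Pat n) → NotR Σ Ψ N Q A →
           (M : Tm n) → ¬ (Inst Σ Ψ M N A × Inst Σ Ψ M Q A)
lemma6p4 _ _ _ _ _ _ _ _ _ N⇒Q _ (M∈N , M∈Q) = not-disjoint N⇒Q M∈N M∈Q
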